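{- Let $a\ge 1$, $r\ge 3$, $p\ge r-1$ and $2\le k\le r-1$ be integers. For large $n$, every $r$-uniform hypergraph $H\in\mathcal{L}^{r}_{n,a,k}$ has property $\bigl(\lfloor(a+\tfrac{1}{k})p\rfloor+1,\,p+1\bigr)$. Furthermore, $$t_{r}\bigl(\lfloor(a+\tfrac{1}{k})p\rfloor+1,\,p+1\bigr)\le\eta_{r}(a,k).$$
   Context: For integers $n,a\ge 1$, $r\ge 3$ and $2\le k\le r-1$, let $\mathcal{L}^{r}_{n,a,k}$ be the family of $r$-uniform hypergraphs $H$ on $n$ vertices whose vertex set admits a partition $V(H)=V_{1}\cup\cdots\cup V_{a}$ with $V_{a}=U_{0}\cup U_{1}\cup\cdots\cup U_{k}$ (a partition of $V_a$) such that $E(H)=\bigl(\bigcup_{i=1}^{a-1}\binom{V_{i}}{r}\bigr)\cup\bigl(\bigcup_{j=0}^{k}\binom{V_{a}\setminus U_{j}}{r}\bigr)$. Let $\eta_{r}(n,a,k)=\min\{e(H): H\in\mathcal{L}^{r}_{n,a,k}\}$ and $\eta_{r}(a,k)=\lim_{n\to\infty}\eta_{r}(n,a,k)/\binom{n}{r}$. A vertex set is a clique if all its $r$-subsets are edges; $H$ has property $(q,p)$ if every $q$-element vertex subset contains a $p$-element clique. $T_{r}(n,q,p)=\min\{e(H): H\subseteq\binom{[n]}{r} \text{ has property } (q,p)\}$ and $t_r(q,p)=\lim_{n\to\infty}T_r(n,q,p)/\binom{n}{r}$. -}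

module Defs where

open import Data.Nat using (ℕ; zero; suc; _+_; _*_; _∸_; _≤_; _/_)
open import Data.Bool using (Bool; true; false)
open import Data.Fin using (Fin; toℕ)
open import Data.Fin.Subset using (Subset; ∣_∣; _⊆_; _∈_; _∉_; _∩_; ⊥)
open import Data.Vec using (Vec; []; _∷_)
open import Data.List using (List; []; _∷_; _++_; map)
open import Data.Product using (Σ; ∃; _×_; ∃-syntax)
open import Function.Bundles using (_⇔_)
open import Relation.Binary.PropositionalEquality using (_≡_)

Hypergraph : ℕ → Set
Hypergraph n = Subset n → Bool

Uniform : (r : ℕ) {n : ℕ} → Hypergraph n → Set
Uniform r {n} H = ∀ (S : Subset n) → H S ≡ true → ∣ S ∣ ≡ r

allSubsets : (n : ℕ) → List (Subset n)
allSubsets zero = [] ∷ []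
allSubsets (suc n) = map (true ∷_) (allSubsets n) ++ map (false ∷_) (allSubsets n)

countTrue : {A : Set} → (A → Bool) → List A → ℕ
countTrue f [] = 0
countTrue f (x ∷ xs) with f x
... | true = suc (countTrue f xs)
... | false = countTrue f xs

edges : {n : ℕ} → Hypergraph n → ℕ
edges {n} H = countTrue H (allSubsets n)

IsClique : (r : ℕ) {n : ℕ} → Hypergraph n → Subset n → Set
IsClique r {n} H S = ∀ (T : Subset n) → T ⊆ S → ∣ T ∣ ≡ r → H T ≡ true

HasProperty : (r : ℕ) {n : ℕ} → Hypergraph n → ℕ → ℕ → Set
HasProperty r {n} H q p =
  ∀ (Q : Subset n) → ∣ Q ∣ ≡ q →
    ∃[ P ] (P ⊆ Q × ∣ P ∣ ≡ p × IsClique r H P)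

-- Partition data: f assigns each vertex its part V_{1..a} (indexed by Fin a,
-- the last index a-1 standing for V_a); g assigns to each vertex an index
-- j ∈ {0..k} (only relevant for vertices in V_a, giving V_a = U_0 ∪ ... ∪ U_k).
-- Parts may be empty.

InPart : {n a : ℕ} → (Fin n → Fin a) → Fin a → Subset n → Set
InPart {n} f i S = ∀ (v : Fin n) → v ∈ S → f v ≡ i

AvoidsU : {n k : ℕ} → (Fin n → Fin (suc k)) → Fin (suc k) → Subset n → Set
AvoidsU {n} g j S = ∀ (v : Fin n) → v ∈ S → ¬≡ (g v) j
  where
  open import Relation.Nullary using (¬_)
  ¬≡ : Fin _ → Fin _ → Set
  ¬≡ x y = ¬ (x ≡ y)

LEdge : (r : ℕ) {n a k : ℕ} → (Fin n → Fin a) → (Fin n → Fin (suc k)) → Subset n → Set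
LEdge r {n} {a} {k} f g S =
  ∣ S ∣ ≡ r ×
  ((Σ (Fin a) λ i → (suc (toℕ i) Data.Nat.< a) × InPart f i S)
   Data.Sum.⊎
   (Σ (Fin a) λ i → (suc (toℕ i) ≡ a) × InPart f i S ×
     Σ (Fin (suc k)) λ j → AvoidsU g j S))
  where
  import Data.Nat
  import Data.Sum

InL : (r n a k : ℕ) → Hypergraph n → Set
InL r n a k H =
  Σ (Fin n → Fin a) λ f → Σ (Fin n → Fin (suc k)) λ g →
    ∀ (S : Subset n) → (H S ≡ true) ⇔ LEdge r f g S

IsEtaMin : (r n a k m : ℕ) → Set
IsEtaMin r n a k m =
  (Σ (Hypergraph n) λ H → InL r n a k H × edges H ≡ m) ×
  (∀ (H : Hypergraph n) → InL r n a k H → m ≤ edges H)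

IsTMin : (r n q p m : ℕ) → Set
IsTMin r n q p m =
  (Σ (Hypergraph n) λ H → Uniform r H × HasProperty r H q p × edges H ≡ m) ×
  (∀ (H : Hypergraph n) → Uniform r H → HasProperty r H q p → m ≤ edges H)

-- ⌊(a + 1/k) p⌋ = ⌊(a k p + p) / k⌋  (k ≥ 1)
qValue : (a k p : ℕ) → ℕ
qValue a zero p = 0
qValue a (suc k) p = ((a * suc k * p) + p) / suc k

choose : ℕ → ℕ → ℕ
choose n zero = 1
choose zero (suc k) = 0
choose (suc n) (suc k) = choose n k + choose n (suc k)

{-# OPTIONS --safe #-}
module Submission where

-- Let Q be a set of ⌊(a + 1/k) p⌋ + 1 vertices of H ∈ 𝓛. The blocks V_1, …, V_{a-1} and
-- V_a ∖ U_j (0 ≤ j ≤ k) are cliques, so it suffices that Q meets one of them in more than p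
-- vertices. Otherwise each of the first a - 1 blocks takes at most p vertices of Q, and since
-- every vertex of V_a lies in exactly k of the k + 1 sets V_a ∖ U_j, k ∣Q ∩ V_a∣ ≤ (k + 1) p;
-- together ∣Q∣ ≤ (a - 1) p + ⌊(1 + 1/k) p⌋ = ⌊(a + 1/k) p⌋, a contradiction. The bound on t_r
-- holds already for every n: a minimal member of 𝓛 is admissible for T_r.

open import Defs
open import Data.Nat using (ℕ; suc; _+_; _*_; _∸_; _≤_; _<_)
open import Data.Product using (_×_; Σ)

open import Data.Bool using (true)
open import Data.Empty using (⊥-elim)
open import Data.Fin using (Fin; toℕ; fromℕ; inject₁; _≟_) renaming (zero to fzero; suc to fsuc)
open import Data.Fin.Properties using (any?; inject₁ℕ<; toℕ-fromℕ)
open import Data.Fin.Subset using (Subset; ∣_∣; _⊆_; _∈_; _∩_; ∁; ⊥; inside; outside)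
open import Data.Fin.Subset.Properties using (∉⊥; ∣⊥∣≡0; p∩q⊆p; p∩q⊆q; x∈∁p⇒x∉p; ∩-assoc)
open import Data.Nat using (zero; z≤n; s≤s; _<?_)
open import Data.Nat.DivMod using (_/_; m*n/n≡m; /-monoˡ-≤)
open import Data.Nat.Properties
  using (+-0-commutativeMonoid; +-suc; +-cancelˡ-≡; *-comm; *-distribʳ-+; ≤-trans; ≤-reflexive;
         +-mono-≤; +-monoˡ-≤; +-monoʳ-≤; *-monoʳ-≤; m≤m+n; n≤1+n; 1+n≰n; ≮⇒≥; module ≤-Reasoning)
open import Data.Nat.Tactic.RingSolver using (solve-∀)
open import Data.Product using (_,_; proj₁; ∃-syntax)
open import Data.Sum using (_⊎_; inj₁; inj₂)
open import Data.Vec using ([]; _∷_; tabulate; here; there)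
open import Data.Vec.Properties using (lookup∘tabulate; []=⇒lookup; lookup⇒[]=)
open import Function.Bundles using (Equivalence; _⇔_)
open import Relation.Binary.PropositionalEquality using (_≡_; refl; sym; trans; cong; subst; module ≡-Reasoning)
open import Relation.Nullary using (does; yes; no; contradiction)
open import Relation.Nullary.Decidable using (dec-true)

open import Algebra.Properties.CommutativeMonoid.Sum +-0-commutativeMonoid
  using (sum; sum-syntax; ∑-distrib-+; sum-cong-≗; sum-init-last; sum-replicate-zero)

fibre : ∀ {n m} → (Fin n → Fin m) → Fin m → Subset n
fibre f i = tabulate (λ v → does (f v ≟ i))

∈-fibre⁻ : ∀ {n m} (f : Fin n → Fin m) {i v} → v ∈ fibre f i → f v ≡ i
∈-fibre⁻ f {i} {v} v∈ with f v ≟ i | trans (sym (lookup∘tabulate _ v)) ([]=⇒lookup v∈)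
... | yes fv≡i | _ = fv≡i
... | no _ | ()

∈-fibre⁺ : ∀ {n m} (f : Fin n → Fin m) {i v} → f v ≡ i → v ∈ fibre f i
∈-fibre⁺ f {i} {v} fv≡i =
  lookup⇒[]= v _ (trans (lookup∘tabulate _ v) (dec-true (f v ≟ i) fv≡i))

sum-const : ∀ m c → ∑[ i < m ] c ≡ m * c
sum-const zero c = refl
sum-const (suc m) c = cong (c +_) (sum-const m c)

sum-≤-const : ∀ {m c} (A : Fin m → ℕ) → (∀ i → A i ≤ c) → sum A ≤ m * c
sum-≤-const {zero} A A≤c = z≤n
sum-≤-const {suc m} A A≤c = +-mono-≤ (A≤c fzero) (sum-≤-const (λ i → A (fsuc i)) (λ i → A≤c (fsuc i)))

≤-or-> : ∀ {m} c (A : Fin m → ℕ) → (∀ i → A i ≤ c) ⊎ ∃[ i ] c < A i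
≤-or-> c A with any? (λ i → c <? A i)
... | yes c<A = inj₂ c<A
... | no ¬c<A = inj₁ (λ i → ≮⇒≥ (λ c<Ai → ¬c<A (i , c<Ai)))

subset-of-size : ∀ {n} m (p : Subset n) → m ≤ ∣ p ∣ → ∃[ q ] (q ⊆ p × ∣ q ∣ ≡ m)
subset-of-size {n} zero p _ = ⊥ , (λ x∈⊥ → contradiction x∈⊥ ∉⊥) , ∣⊥∣≡0 n
subset-of-size (suc m) (inside ∷ p) (s≤s m≤∣p∣) with subset-of-size m p m≤∣p∣
... | q , q⊆p , ∣q∣≡m = inside ∷ q , (λ { here → here ; (there x∈q) → there (q⊆p x∈q) }) , cong suc ∣q∣≡m
subset-of-size (suc m) (outside ∷ p) m<∣p∣ with subset-of-size (suc m) p m<∣p∣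
... | q , q⊆p , ∣q∣≡m = outside ∷ q , (λ { (there x∈q) → there (q⊆p x∈q) }) , ∣q∣≡m

∣p∩q∣+∣p∩∁q∣≡∣p∣ : ∀ {n} (p q : Subset n) → ∣ p ∩ q ∣ + ∣ p ∩ ∁ q ∣ ≡ ∣ p ∣
∣p∩q∣+∣p∩∁q∣≡∣p∣ [] [] = refl
∣p∩q∣+∣p∩∁q∣≡∣p∣ (outside ∷ p) (_ ∷ q) = ∣p∩q∣+∣p∩∁q∣≡∣p∣ p q
∣p∩q∣+∣p∩∁q∣≡∣p∣ (inside ∷ p) (inside ∷ q) = cong suc (∣p∩q∣+∣p∩∁q∣≡∣p∣ p q)
∣p∩q∣+∣p∩∁q∣≡∣p∣ (inside ∷ p) (outside ∷ q) = trans (+-suc _ _) (cong suc (∣p∩q∣+∣p∩∁q∣≡∣p∣ p q))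

∑-∣[x≟i]∷q∣ : ∀ {n m} (x : Fin m) (q : Fin m → Subset n) →
  ∑[ i < m ] ∣ does (x ≟ i) ∷ q i ∣ ≡ suc (∑[ i < m ] ∣ q i ∣)
∑-∣[x≟i]∷q∣ fzero q = refl
∑-∣[x≟i]∷q∣ (fsuc x) q = trans (cong (∣ q fzero ∣ +_) (∑-∣[x≟i]∷q∣ x (λ i → q (fsuc i)))) (+-suc _ _)

∑-∣p∩fibre∣≡∣p∣ : ∀ {n m} (p : Subset n) (f : Fin n → Fin m) → ∑[ i < m ] ∣ p ∩ fibre f i ∣ ≡ ∣ p ∣
∑-∣p∩fibre∣≡∣p∣ {m = m} [] f = sum-replicate-zero m
∑-∣p∩fibre∣≡∣p∣ (outside ∷ p) f = ∑-∣p∩fibre∣≡∣p∣ p (λ v → f (fsuc v))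
∑-∣p∩fibre∣≡∣p∣ (inside ∷ p) f =
  trans (∑-∣[x≟i]∷q∣ (f fzero) (λ i → p ∩ fibre (λ v → f (fsuc v)) i))
        (cong suc (∑-∣p∩fibre∣≡∣p∣ p (λ v → f (fsuc v))))

∑-∣p∩∁fibre∣≡k*∣p∣ : ∀ {n k} (p : Subset n) (g : Fin n → Fin (suc k)) →
  ∑[ j < suc k ] ∣ p ∩ ∁ (fibre g j) ∣ ≡ k * ∣ p ∣
∑-∣p∩∁fibre∣≡k*∣p∣ {k = k} p g = +-cancelˡ-≡ ∣ p ∣ _ _ (begin
  ∣ p ∣ + ∑[ j < suc k ] ∣ p ∩ ∁ (fibre g j) ∣
    ≡⟨ cong (_+ ∑[ j < suc k ] ∣ p ∩ ∁ (fibre g j) ∣) (sym (∑-∣p∩fibre∣≡∣p∣ p g)) ⟩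
  ∑[ j < suc k ] ∣ p ∩ fibre g j ∣ + ∑[ j < suc k ] ∣ p ∩ ∁ (fibre g j) ∣
    ≡⟨ sym (∑-distrib-+ (λ j → ∣ p ∩ fibre g j ∣) (λ j → ∣ p ∩ ∁ (fibre g j) ∣)) ⟩
  ∑[ j < suc k ] (∣ p ∩ fibre g j ∣ + ∣ p ∩ ∁ (fibre g j) ∣)
    ≡⟨ sum-cong-≗ (λ j → ∣p∩q∣+∣p∩∁q∣≡∣p∣ p (fibre g j)) ⟩
  ∑[ j < suc k ] ∣ p ∣
    ≡⟨ sum-const (suc k) ∣ p ∣ ⟩
  suc k * ∣ p ∣ ∎)
  where open ≡-Reasoning

≤-qValue : ∀ a k p m → suc k * m ≤ suc (suc k) * p → a * p + m ≤ qValue (suc a) (suc k) p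
≤-qValue a k p m km≤ = begin
  a * p + m                          ≡⟨ m*n/n≡m (a * p + m) (suc k) ⟨
  (a * p + m) * suc k / suc k        ≤⟨ /-monoˡ-≤ (suc k) bound ⟩
  (suc a * suc k * p + p) / suc k    ∎
  where
  open ≤-Reasoning
  regroup : ∀ x y z → x * z * suc y + suc (suc y) * z ≡ suc x * suc y * z + z
  regroup = solve-∀
  bound : (a * p + m) * suc k ≤ suc a * suc k * p + p
  bound = begin
    (a * p + m) * suc k            ≡⟨ *-distribʳ-+ (suc k) (a * p) m ⟩
    a * p * suc k + m * suc k      ≤⟨ +-monoʳ-≤ (a * p * suc k) (≤-trans (≤-reflexive (*-comm m (suc k))) km≤) ⟩
    a * p * suc k + suc (suc k) * p ≡⟨ regroup a k p ⟩
    suc a * suc k * p + p          ∎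

∣p∣≤a*c+∣p∩last-fibre∣ : ∀ {n a c} (p : Subset n) (f : Fin n → Fin (suc a)) →
  (∀ i → ∣ p ∩ fibre f (inject₁ i) ∣ ≤ c) → ∣ p ∣ ≤ a * c + ∣ p ∩ fibre f (fromℕ a) ∣
∣p∣≤a*c+∣p∩last-fibre∣ {a = a} {c} p f small = begin
  ∣ p ∣                                                         ≡⟨ ∑-∣p∩fibre∣≡∣p∣ p f ⟨
  ∑[ i < suc a ] ∣ p ∩ fibre f i ∣                              ≡⟨ sum-init-last (λ i → ∣ p ∩ fibre f i ∣) ⟩
  ∑[ i < a ] ∣ p ∩ fibre f (inject₁ i) ∣ + ∣ p ∩ fibre f (fromℕ a) ∣
    ≤⟨ +-monoˡ-≤ ∣ p ∩ fibre f (fromℕ a) ∣ (sum-≤-const (λ i → ∣ p ∩ fibre f (inject₁ i) ∣) small) ⟩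
  a * c + ∣ p ∩ fibre f (fromℕ a) ∣                             ∎
  where open ≤-Reasoning

k*∣p∣≤[1+k]*c : ∀ {n k c} (p : Subset n) (g : Fin n → Fin (suc k)) →
  (∀ j → ∣ p ∩ ∁ (fibre g j) ∣ ≤ c) → k * ∣ p ∣ ≤ suc k * c
k*∣p∣≤[1+k]*c p g small =
  ≤-trans (≤-reflexive (sym (∑-∣p∩∁fibre∣≡k*∣p∣ p g))) (sum-≤-const (λ j → ∣ p ∩ ∁ (fibre g j) ∣) small)

large-clique : ∀ {r n} {H : Hypergraph n} {B : Subset n} (Q : Subset n) m →
  IsClique r H B → m ≤ ∣ Q ∩ B ∣ → ∃[ P ] (P ⊆ Q × ∣ P ∣ ≡ m × IsClique r H P)
large-clique {B = B} Q m B-clique m≤ with subset-of-size m (Q ∩ B) m≤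
... | P , P⊆Q∩B , ∣P∣≡m =
  P , (λ x∈P → p∩q⊆p Q B (P⊆Q∩B x∈P)) , ∣P∣≡m ,
  λ T T⊆P → B-clique T (λ x∈T → p∩q⊆q Q B (P⊆Q∩B (T⊆P x∈T)))

-- For H ∈ 𝓛 given by (f , g), fibre f i is the part V_{i+1} and fibre g j is U_j.
module _ {r n a k} {H : Hypergraph n} {f : Fin n → Fin a} {g : Fin n → Fin (suc k)}
         (edge⇔ : ∀ S → (H S ≡ true) ⇔ LEdge r f g S) where

  fibre-isClique : ∀ {i} → suc (toℕ i) < a → IsClique r H (fibre f i)
  fibre-isClique {i} i<a T T⊆ ∣T∣≡r =
    Equivalence.from (edge⇔ T) (∣T∣≡r , inj₁ (i , i<a , λ v v∈T → ∈-fibre⁻ f (T⊆ v∈T)))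

  fibre∩∁fibre-isClique : ∀ {i j} → suc (toℕ i) ≡ a → IsClique r H (fibre f i ∩ ∁ (fibre g j))
  fibre∩∁fibre-isClique {i} {j} i≡a T T⊆ ∣T∣≡r =
    Equivalence.from (edge⇔ T) (∣T∣≡r , inj₂ (i , i≡a ,
      (λ v v∈T → ∈-fibre⁻ f (p∩q⊆p _ _ (T⊆ v∈T))) ,
      j , λ v v∈T gv≡j → x∈∁p⇒x∉p (p∩q⊆q _ _ (T⊆ v∈T)) (∈-fibre⁺ g gv≡j)))

InL⇒Uniform : ∀ {r n a k} {H : Hypergraph n} → InL r n a k H → Uniform r H
InL⇒Uniform (f , g , edge⇔) S S∈H = proj₁ (Equivalence.to (edge⇔ S) S∈H)

InL⇒HasProperty : ∀ {r n a k} p → 1 ≤ a → 1 ≤ k → (H : Hypergraph n) → InL r n a k H →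
  HasProperty r H (suc (qValue a k p)) (suc p)
InL⇒HasProperty {a = suc a} {suc k} p (s≤s _) (s≤s _) H (f , g , edge⇔) Q ∣Q∣≡1+q
  with ≤-or-> p (λ i → ∣ Q ∩ fibre f (inject₁ i) ∣)
... | inj₂ (i , p<) = large-clique Q (suc p) (fibre-isClique edge⇔ (s≤s (inject₁ℕ< i))) p<
... | inj₁ parts≤p with ≤-or-> p (λ j → ∣ (Q ∩ fibre f (fromℕ a)) ∩ ∁ (fibre g j) ∣)
...   | inj₂ (j , p<) =
  large-clique Q (suc p) (fibre∩∁fibre-isClique edge⇔ (cong suc (toℕ-fromℕ a)))
    (subst (suc p ≤_) (cong ∣_∣ (∩-assoc Q (fibre f (fromℕ a)) (∁ (fibre g j)))) p<)
...   | inj₁ pieces≤p = ⊥-elim (1+n≰n (begin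
  suc (qValue (suc a) (suc k) p)       ≡⟨ ∣Q∣≡1+q ⟨
  ∣ Q ∣                                ≤⟨ ∣p∣≤a*c+∣p∩last-fibre∣ Q f parts≤p ⟩
  a * p + ∣ Q ∩ fibre f (fromℕ a) ∣    ≤⟨ ≤-qValue a k p _ (k*∣p∣≤[1+k]*c (Q ∩ fibre f (fromℕ a)) g pieces≤p) ⟩
  qValue (suc a) (suc k) p             ∎))
  where open ≤-Reasoning

T≤η : ∀ {r n a k q p t η} → (∀ (H : Hypergraph n) → InL r n a k H → HasProperty r H q p) →
  IsTMin r n q p t → IsEtaMin r n a k η → t ≤ η
T≤η 𝓛-has-property (_ , t-least) ((H , H∈𝓛 , eH≡η) , _) =
  ≤-trans (t-least H (InL⇒Uniform H∈𝓛) (𝓛-has-property H H∈𝓛)) (≤-reflexive eH≡η)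

theorem3p7 : (a r p k : ℕ) → 1 ≤ a → 3 ≤ r → r ∸ 1 ≤ p → 2 ≤ k → k ≤ r ∸ 1 →
    (Σ ℕ λ N → ∀ (n : ℕ) → N ≤ n → ∀ (H : Hypergraph n) → InL r n a k H →
      HasProperty r H (suc (qValue a k p)) (suc p))
    ×
    (∀ (u v : ℕ) → 0 < u → 0 < v →
      Σ ℕ λ N → ∀ (n : ℕ) → N ≤ n → ∀ (t η : ℕ) →
        IsTMin r n (suc (qValue a k p)) (suc p) t → IsEtaMin r n a k η →
        v * t ≤ v * η + u * choose n r)
theorem3p7 a r p k 1≤a _ _ 2≤k _ =
  (0 , λ n _ → 𝓛-has-property) ,
  λ u v _ _ → 0 , λ n _ t η t-min η-min →
    ≤-trans (*-monoʳ-≤ v (T≤η 𝓛-has-property t-min η-min)) (m≤m+n (v * η) (u * choose n r))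
  where
  𝓛-has-property : ∀ {n} (H : Hypergraph n) → InL r n a k H → HasProperty r H (suc (qValue a k p)) (suc p)
  𝓛-has-property = InL⇒HasProperty p 1≤a (≤-trans (n≤1+n 1) 2≤k)
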